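{- Let $d$ be a positive integer and let $U \leq T_d$ be a surface subgroup such that $(T_d/U,a,b,c)$ is a geodesic self-dual degree-$d$-surface. Then the normal closure of $(bac)^d$ in $T_d$ is contained in $U$.
   Context: $T_d = \langle a,b,c \mid a^2,b^2,c^2,(ab)^3,(ac)^2,(bc)^d\rangle$. A surface is a quadruple $(\mathcal{F},\alpha,\beta,\gamma)$ with $\mathcal{F}$ a set and $\alpha,\beta,\gamma$ permutations of $\mathcal{F}$ such that: $\alpha,\beta,\gamma$ are fixed-point-free involutions; $\langle\alpha,\beta,\gamma\rangle$ is transitive on $\mathcal{F}$; $\alpha\beta$ consists only of 3-cycles; $\alpha\gamma$ consists only of 2-cycles. It is a degree-$d$-surface if also $\beta\gamma$ consists only of $d$-cycles. $T_d$ acts on the flags via $a\mapsto\alpha$, $b\mapsto\beta$, $c\mapsto\gamma$; $U\le T_d$ is a surface subgroup if the left multiplication action of $T_d$ on $T_d/U$ is equivariant to this action for some degree-$d$-surface. $(T_d/U,a,b,c)$ has flags the left cosets of $U$ and permutations the left multiplications by $a,b,c$. The geodesic dual of $(\mathcal{F},\alpha,\beta,\gamma)$ is $(\mathcal{F},\alpha,\beta,\alpha\gamma)$; an isomorphism $(\mathcal{F},\alpha,\beta,\gamma)\to(\mathcal{G},\rho,\sigma,\tau)$ is a bijection $\phi$ with $\phi^{ -1}\alpha\phi=\rho$, $\phi^{ -1}\beta\phi=\sigma$, $\phi^{ -1}\gamma\phi=\tau$; a surface is geodesic self-dual if isomorphic to its geodesic dual. -}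

module Defs where

open import Data.Nat using (ℕ; zero; suc; _<_)
open import Data.List using (List; []; _∷_; _++_; reverse)
open import Data.Product using (Σ; _×_; ∃)
open import Relation.Nullary using (¬_)
open import Relation.Binary.PropositionalEquality using (_≡_)
open import Level using (Level; _⊔_) renaming (suc to lsuc)

-- Since every generator is an involution, every element of T_d is
-- represented by a word over {a,b,c}; the inverse of a word is its reverse.

data Gen : Set where
  a b c : Gen

Word : Set
Word = List Gen

_^^_ : Word → ℕ → Word
w ^^ zero  = []
w ^^ suc n = w ++ (w ^^ n)

data Relator (d : ℕ) : Word → Set where
  r-aa : Relator d (a ∷ a ∷ [])
  r-bb : Relator d (b ∷ b ∷ [])
  r-cc : Relator d (c ∷ c ∷ [])
  r-ab : Relator d ((a ∷ b ∷ []) ^^ 3)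
  r-ac : Relator d ((a ∷ c ∷ []) ^^ 2)
  r-bc : Relator d ((b ∷ c ∷ []) ^^ d)

-- equality of words as elements of T_d: the congruence generated by the relators
data TEq (d : ℕ) : Word → Word → Set where
  teq-refl  : ∀ {x} → TEq d x x
  teq-sym   : ∀ {x y} → TEq d x y → TEq d y x
  teq-trans : ∀ {x y z} → TEq d x y → TEq d y z → TEq d x z
  teq-rel   : ∀ {r} → Relator d r → (u v : Word) → TEq d (u ++ (r ++ v)) (u ++ v)

record IsSubgroup (d : ℕ) (U : Word → Set) : Set where
  field
    resp : ∀ {x y} → TEq d x y → U x → U y
    one  : U []
    mul  : ∀ {x y} → U x → U y → U (x ++ y)
    inv  : ∀ {x} → U x → U (reverse x)

data NormalClosure (d : ℕ) (g : Word) : Word → Set where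
  nc-gen  : NormalClosure d g g
  nc-resp : ∀ {x y} → TEq d x y → NormalClosure d g x → NormalClosure d g y
  nc-one  : NormalClosure d g []
  nc-mul  : ∀ {x y} → NormalClosure d g x → NormalClosure d g y → NormalClosure d g (x ++ y)
  nc-inv  : ∀ {x} → NormalClosure d g x → NormalClosure d g (reverse x)
  nc-conj : ∀ {x} (h : Word) → NormalClosure d g x → NormalClosure d g (h ++ (x ++ reverse h))

-- Surfaces.  A "quadruple" (F, α, β, γ) is given by a carrier A with an
-- equality relation _≈_ (propositional equality for a plain set, the coset
-- relation for T_d/U) and three maps.

iter : ∀ {ℓ} {A : Set ℓ} → ℕ → (A → A) → A → A
iter zero    f x = x
iter (suc n) f x = f (iter n f x)

act : ∀ {ℓ} {A : Set ℓ} → (A → A) → (A → A) → (A → A) → Word → A → A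
act α β γ []      x = x
act α β γ (a ∷ w) x = α (act α β γ w x)
act α β γ (b ∷ w) x = β (act α β γ w x)
act α β γ (c ∷ w) x = γ (act α β γ w x)

module _ {ℓ ℓ' : Level} {A : Set ℓ} (_≈_ : A → A → Set ℓ') where

  IsFPFInvolution : (A → A) → Set (ℓ ⊔ ℓ')
  IsFPFInvolution f =
    (∀ {x y} → x ≈ y → f x ≈ f y) × (∀ x → f (f x) ≈ x) × (∀ x → ¬ (f x ≈ x))

  OnlyCycles : ℕ → (A → A) → Set (ℓ ⊔ ℓ')
  OnlyCycles n f = ∀ x → (iter n f x ≈ x) × (∀ k → 0 < k → k < n → ¬ (iter k f x ≈ x))

  record IsSurface (α β γ : A → A) : Set (ℓ ⊔ ℓ') where
    field
      invα : IsFPFInvolution α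
      invβ : IsFPFInvolution β
      invγ : IsFPFInvolution γ
      transitive : ∀ x y → ∃ λ (w : Word) → act α β γ w x ≈ y
      αβ-3cycles : OnlyCycles 3 (λ x → α (β x))
      αγ-2cycles : OnlyCycles 2 (λ x → α (γ x))

  record IsDegSurface (d : ℕ) (α β γ : A → A) : Set (ℓ ⊔ ℓ') where
    field
      surface    : IsSurface α β γ
      βγ-dcycles : OnlyCycles d (λ x → β (γ x))

record IsIso {ℓ₁ ℓ₁' ℓ₂ ℓ₂' : Level} {A : Set ℓ₁} {B : Set ℓ₂}
             (_≈₁_ : A → A → Set ℓ₁') (_≈₂_ : B → B → Set ℓ₂')
             (α β γ : A → A) (ρ σ τ : B → B) (φ : A → B)
             : Set (ℓ₁ ⊔ ℓ₁' ⊔ ℓ₂ ⊔ ℓ₂') where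
  field
    cong       : ∀ {x y} → x ≈₁ y → φ x ≈₂ φ y
    injective  : ∀ {x y} → φ x ≈₂ φ y → x ≈₁ y
    surjective : ∀ y → ∃ λ x → φ x ≈₂ y
    comm-α     : ∀ x → φ (α x) ≈₂ ρ (φ x)
    comm-β     : ∀ x → φ (β x) ≈₂ σ (φ x)
    comm-γ     : ∀ x → φ (γ x) ≈₂ τ (φ x)

GeodesicSelfDual : ∀ {ℓ ℓ'} {A : Set ℓ} (_≈_ : A → A → Set ℓ') (α β γ : A → A) → Set (ℓ ⊔ ℓ')
GeodesicSelfDual {A = A} _≈_ α β γ =
  ∃ λ (φ : A → A) → IsIso _≈_ _≈_ α β γ α β (λ x → α (γ x)) φ

-- The quadruple (T_d/U, a, b, c): left cosets xU, yU are equal iff x⁻¹y ∈ U;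
-- the permutations are left multiplication by a, b, c.

CosetEq : (U : Word → Set) → Word → Word → Set
CosetEq U x y = U (reverse x ++ y)

lmul : Gen → Word → Word
lmul g x = g ∷ x

IsSurfaceSubgroup : (d : ℕ) → (U : Word → Set) → Set₁
IsSurfaceSubgroup d U =
  IsSubgroup d U ×
  Σ Set λ F → Σ (F → F) λ α → Σ (F → F) λ β → Σ (F → F) λ γ →
    IsDegSurface _≡_ d α β γ ×
    ∃ λ (φ : Word → F) →
      IsIso (CosetEq U) _≡_ (lmul a) (lmul b) (lmul c) α β γ φ

-- A duality isomorphism φ : (T_d/U, a, b, c) → (T_d/U, a, b, ac)
-- intertwines left multiplication by bc with left multiplication by bac, so
-- φ ∘ (bc)^n = (bac)^n ∘ φ on cosets.  In a degree-d surface (bc)^d fixes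
-- every coset; as φ is surjective, (bac)^d fixes every coset xU, i.e.
-- x⁻¹ (bac)^d x ∈ U for every x.  The set of w all of whose conjugates lie
-- in U is a normal subgroup, so it contains the normal closure of (bac)^d.
module Submission where

open import Defs
open import Level using (Level)
open import Data.Nat using (ℕ; _<_; zero; suc)
open import Data.List using ([]; _∷_; _++_; reverse)
open import Data.List.Properties using (++-assoc; ++-identityʳ; reverse-++; reverse-involutive)
open import Data.Product using (_,_; proj₁; ∃-syntax)
open import Function using (_∘_)
open import Relation.Binary.Structures using (IsEquivalence)
open import Relation.Binary.PropositionalEquality using (_≡_; refl; sym; trans; cong; subst)

module WordEquality {d : ℕ} where

  ≡⇒TEq : ∀ {x y} → x ≡ y → TEq d x y
  ≡⇒TEq refl = teq-refl

  infixr 4 _⟫_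
  _⟫_ : ∀ {x y z} → TEq d x y → TEq d y z → TEq d x z
  _⟫_ = teq-trans

  TEq-context : ∀ {x y} → TEq d x y → (u v : Word) → TEq d (u ++ (x ++ v)) (u ++ (y ++ v))
  TEq-context teq-refl        u v = teq-refl
  TEq-context (teq-sym p)     u v = teq-sym (TEq-context p u v)
  TEq-context (teq-trans p q) u v = TEq-context p u v ⟫ TEq-context q u v
  TEq-context (teq-rel {r} R u′ v′) u v =
    ≡⇒TEq regroup ⟫ teq-rel R (u ++ u′) (v′ ++ v) ⟫ ≡⇒TEq ungroup
    where
    regroup : u ++ ((u′ ++ (r ++ v′)) ++ v) ≡ (u ++ u′) ++ (r ++ (v′ ++ v))
    regroup = trans (cong (u ++_) (trans (++-assoc u′ (r ++ v′) v) (cong (u′ ++_) (++-assoc r v′ v))))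
                    (sym (++-assoc u u′ (r ++ (v′ ++ v))))
    ungroup : (u ++ u′) ++ (v′ ++ v) ≡ u ++ ((u′ ++ v′) ++ v)
    ungroup = trans (++-assoc u u′ (v′ ++ v)) (cong (u ++_) (sym (++-assoc u′ v′ v)))

  generator-involution : (g : Gen) → Relator d (g ∷ g ∷ [])
  generator-involution a = r-aa
  generator-involution b = r-bb
  generator-involution c = r-cc

  reverse-cancel : (u h v : Word) → TEq d (u ++ (reverse h ++ (h ++ v))) (u ++ v)
  reverse-cancel u []      v = teq-refl
  reverse-cancel u (g ∷ h) v =
    ≡⇒TEq expose-gg
      ⟫ TEq-context (teq-rel (generator-involution g) [] []) (u ++ reverse h) (h ++ v)
      ⟫ ≡⇒TEq (++-assoc u (reverse h) (h ++ v))
      ⟫ reverse-cancel u h v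
    where
    expose-gg : u ++ (reverse (g ∷ h) ++ (g ∷ h ++ v)) ≡ (u ++ reverse h) ++ ((g ∷ g ∷ []) ++ (h ++ v))
    expose-gg = trans (cong (λ z → u ++ (z ++ (g ∷ h ++ v))) (reverse-++ (g ∷ []) h))
                (trans (cong (u ++_) (++-assoc (reverse h) (g ∷ []) (g ∷ h ++ v)))
                       (sym (++-assoc u (reverse h) (g ∷ g ∷ h ++ v))))

open WordEquality

module Intertwining {ℓ ℓ′ : Level} {A : Set ℓ} {_≈_ : A → A → Set ℓ′}
                    (≈-equiv : IsEquivalence _≈_) (φ f g : A → A)
                    (g-cong : ∀ {x y} → x ≈ y → g x ≈ g y)
                    (intertwines : ∀ x → φ (f x) ≈ g (φ x)) where
  open IsEquivalence ≈-equiv renaming (refl to ≈-refl; sym to ≈-sym; trans to ≈-trans)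

  iter-cong : ∀ n {x y} → x ≈ y → iter n g x ≈ iter n g y
  iter-cong zero    p = p
  iter-cong (suc n) p = g-cong (iter-cong n p)

  iter-intertwines : ∀ n x → φ (iter n f x) ≈ iter n g (φ x)
  iter-intertwines zero    x = ≈-refl
  iter-intertwines (suc n) x = ≈-trans (intertwines (iter n f x)) (g-cong (iter-intertwines n x))

  periodicity-transfer : ∀ n → (∀ {x y} → x ≈ y → φ x ≈ φ y) → (∀ y → ∃[ x ] φ x ≈ y) →
    (∀ x → iter n f x ≈ x) → ∀ y → iter n g y ≈ y
  periodicity-transfer n φ-cong φ-surj f-periodic y with φ-surj y
  ... | x , φx≈y =
    ≈-trans (iter-cong n (≈-sym φx≈y))
    (≈-trans (≈-sym (iter-intertwines n x))
    (≈-trans (φ-cong (f-periodic x)) φx≈y))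

-- CosetEq U x y
-- computes to U (reverse x ++ y), from which Agda cannot recover x and y,
-- so the endpoints of ≈-proofs are sometimes supplied explicitly.
module Cosets (d : ℕ) (U : Word → Set) (U-subgroup : IsSubgroup d U) where
  open IsSubgroup U-subgroup

  _≈_ : Word → Word → Set
  _≈_ = CosetEq U

  ≈-refl : ∀ {x} → x ≈ x
  ≈-refl {x} = resp (teq-sym (≡⇒TEq (sym (++-identityʳ (reverse x ++ x)))
                              ⟫ ≡⇒TEq (++-assoc (reverse x) x [])
                              ⟫ reverse-cancel [] x [])) one

  ≈-sym : ∀ {x y} → x ≈ y → y ≈ x
  ≈-sym {x} {y} p =
    subst U (trans (reverse-++ (reverse x) y) (cong (reverse y ++_) (reverse-involutive x))) (inv p)

  ≈-trans : ∀ {x y z} → x ≈ y → y ≈ z → x ≈ z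
  ≈-trans {x} {y} {z} p q =
    resp (≡⇒TEq insert-y⁻¹⁻¹ ⟫ reverse-cancel (reverse x) (reverse y) z) (mul p q)
    where
    insert-y⁻¹⁻¹ : (reverse x ++ y) ++ (reverse y ++ z) ≡ reverse x ++ (reverse (reverse y) ++ (reverse y ++ z))
    insert-y⁻¹⁻¹ = trans (++-assoc (reverse x) y (reverse y ++ z))
                         (cong (λ w → reverse x ++ (w ++ (reverse y ++ z))) (sym (reverse-involutive y)))

  ≈-isEquivalence : IsEquivalence _≈_
  ≈-isEquivalence = record
    { refl  = λ {x} → ≈-refl {x}
    ; sym   = λ {x} {y} → ≈-sym {x} {y}
    ; trans = λ {x} {y} {z} → ≈-trans {x} {y} {z}
    }

  ≈-leftMul : ∀ p {x y} → x ≈ y → (p ++ x) ≈ (p ++ y)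
  ≈-leftMul p {x} {y} q = resp (teq-sym (≡⇒TEq split ⟫ reverse-cancel (reverse x) p y)) q
    where
    split : reverse (p ++ x) ++ (p ++ y) ≡ reverse x ++ (reverse p ++ (p ++ y))
    split = trans (cong (_++ (p ++ y)) (reverse-++ p x)) (++-assoc (reverse x) (reverse p) (p ++ y))

  Core : Word → Set
  Core w = ∀ h → U (h ++ (w ++ reverse h))

  fixes-all-cosets⇒Core : ∀ {w} → (∀ x → (w ++ x) ≈ x) → Core w
  fixes-all-cosets⇒Core {w} fixes h =
    subst U (cong (_++ (w ++ reverse h)) (reverse-involutive h)) (≈-sym {w ++ reverse h} (fixes (reverse h)))

  Core-resp : ∀ {x y} → TEq d x y → Core x → Core y
  Core-resp p x∈ h = resp (TEq-context p h (reverse h)) (x∈ h)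

  Core-one : Core []
  Core-one h = subst U (cong (_++ reverse h) (reverse-involutive h)) (≈-refl {reverse h})

  Core-mul : ∀ {x y} → Core x → Core y → Core (x ++ y)
  Core-mul {x} {y} x∈ y∈ h =
    resp (≡⇒TEq regroup ⟫ reverse-cancel (h ++ x) h (y ++ reverse h) ⟫ ≡⇒TEq ungroup)
         (mul (x∈ h) (y∈ h))
    where
    regroup : (h ++ (x ++ reverse h)) ++ (h ++ (y ++ reverse h)) ≡ (h ++ x) ++ (reverse h ++ (h ++ (y ++ reverse h)))
    regroup = trans (++-assoc h (x ++ reverse h) _)
              (trans (cong (h ++_) (++-assoc x (reverse h) _)) (sym (++-assoc h x _)))
    ungroup : (h ++ x) ++ (y ++ reverse h) ≡ h ++ ((x ++ y) ++ reverse h)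
    ungroup = trans (++-assoc h x _) (cong (h ++_) (sym (++-assoc x y _)))

  Core-inv : ∀ {x} → Core x → Core (reverse x)
  Core-inv {x} x∈ h = subst U reverse-conjugate (inv (x∈ h))
    where
    reverse-conjugate : reverse (h ++ (x ++ reverse h)) ≡ h ++ (reverse x ++ reverse h)
    reverse-conjugate =
      trans (reverse-++ h (x ++ reverse h))
      (trans (cong (_++ reverse h) (trans (reverse-++ x (reverse h)) (cong (_++ reverse x) (reverse-involutive h))))
             (++-assoc h (reverse x) (reverse h)))

  Core-conj : ∀ {x} (h′ : Word) → Core x → Core (h′ ++ (x ++ reverse h′))
  Core-conj {x} h′ x∈ h = subst U merge (x∈ (h ++ h′))
    where
    merge : (h ++ h′) ++ (x ++ reverse (h ++ h′)) ≡ h ++ ((h′ ++ (x ++ reverse h′)) ++ reverse h)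
    merge = trans (cong (λ w → (h ++ h′) ++ (x ++ w)) (reverse-++ h h′))
            (trans (++-assoc h h′ _)
            (cong (h ++_) (trans (cong (h′ ++_) (sym (++-assoc x (reverse h′) (reverse h))))
                                 (sym (++-assoc h′ (x ++ reverse h′) (reverse h))))))

  -- The normal core is a normal subgroup, so it contains the normal closure
  -- of each of its elements; taking the trivial conjugate gives ⊆ U.
  NormalClosure⊆Core : ∀ {g w} → Core g → NormalClosure d g w → Core w
  NormalClosure⊆Core g∈ nc-gen          = g∈
  NormalClosure⊆Core g∈ (nc-resp p n)   = Core-resp p (NormalClosure⊆Core g∈ n)
  NormalClosure⊆Core g∈ nc-one          = Core-one
  NormalClosure⊆Core g∈ (nc-mul n m)    = Core-mul (NormalClosure⊆Core g∈ n) (NormalClosure⊆Core g∈ m)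
  NormalClosure⊆Core g∈ (nc-inv n)      = Core-inv (NormalClosure⊆Core g∈ n)
  NormalClosure⊆Core g∈ (nc-conj h′ n)  = Core-conj h′ (NormalClosure⊆Core g∈ n)

  NormalClosure⊆U : ∀ {g w} → Core g → NormalClosure d g w → U w
  NormalClosure⊆U {w = w} g∈ n = subst U (++-identityʳ w) (NormalClosure⊆Core g∈ n [])

bac· : Word → Word
bac· x = b ∷ a ∷ c ∷ x

iter-bac : ∀ n x → iter n bac· x ≡ ((b ∷ a ∷ c ∷ []) ^^ n) ++ x
iter-bac zero    x = refl
iter-bac (suc n) x = cong bac· (iter-bac n x)

lemma4p9 : (d : ℕ) → 0 < d → (U : Word → Set) →
    IsSurfaceSubgroup d U →
    IsDegSurface (CosetEq U) d (lmul a) (lmul b) (lmul c) →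
    GeodesicSelfDual (CosetEq U) (lmul a) (lmul b) (lmul c) →
    ∀ w → NormalClosure d ((b ∷ a ∷ c ∷ []) ^^ d) w → U w
lemma4p9 d _ U (U-subgroup , _) deg (φ , φ-iso) w =
  NormalClosure⊆U (fixes-all-cosets⇒Core bacᵈ-fixes-cosets)
  where
  open Cosets d U U-subgroup
  open IsIso φ-iso renaming (cong to φ-cong)

  -- φ(bc·x) = b·φ(c·x) = b·(ac)·φ(x): φ turns bc into bac.
  φ-bc≈bac-φ : ∀ x → φ (b ∷ c ∷ x) ≈ bac· (φ x)
  φ-bc≈bac-φ x = ≈-trans {φ (b ∷ c ∷ x)} {b ∷ φ (c ∷ x)} (comm-β (c ∷ x))
                         (≈-leftMul (b ∷ []) {φ (c ∷ x)} (comm-γ x))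

  bac·-cong : ∀ {x y} → x ≈ y → bac· x ≈ bac· y
  bac·-cong {x} {y} = ≈-leftMul (b ∷ a ∷ c ∷ []) {x} {y}

  open Intertwining {_≈_ = _≈_} ≈-isEquivalence φ (λ x → b ∷ c ∷ x) bac·
    (λ {x} {y} → bac·-cong {x} {y}) φ-bc≈bac-φ using (periodicity-transfer)

  -- (bc)^d fixes every coset, hence so does (bac)^d.
  bacᵈ-fixes-cosets : ∀ x → (((b ∷ a ∷ c ∷ []) ^^ d) ++ x) ≈ x
  bacᵈ-fixes-cosets x =
    subst (λ y → y ≈ x) (iter-bac d x)
      (periodicity-transfer d φ-cong surjective (proj₁ ∘ IsDegSurface.βγ-dcycles deg) x)
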